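{- Every generalized Zeckendorf game played on a positive integer $n$ terminates within a finite number of moves, and it terminates at the unique legal decomposition of $n$, i.e. the final multiset consists of $s_i$ copies of $a_i$ for each $i$, where $n=\sum_i s_i a_i$ is the legal decomposition of $n$.
   Context: Let $a_1=1$, $a_2=2$ and $a_{i+1}=i\,a_i+a_{i-1}$ for $i\ge 2$ (so $a_3=5$, $a_4=17$, $a_5=73,\dots$). A legal decomposition of $n$ is $n=\sum_i s_i a_i$ with $s_i\in\{0,\dots,i\}$ and, if $s_i=i$, then $s_{i-1}=0$; it exists and is unique. The generalized Zeckendorf game on $n$: the state is a multiset of terms of the sequence, initially $n$ copies of $a_1=1$. A move is one of: (combining) replace two $1$'s by one $2$; or, for $i\ge 2$, if the multiset contains at least $i$ copies of $a_i$ and at least one $a_{i-1}$, replace $i$ copies of $a_i$ and one $a_{i-1}$ by one $a_{i+1}$; (splitting) if it contains three $2$'s, replace them by one $1$ and one $5$; or, for $i\ge 3$, if it contains $i+1$ copies of $a_i$, replace them by one $a_{i+1}$, $i-2$ copies of $a_{i-1}$ and one $a_{i-2}$. Players (any number $p\ge1$) alternate moves in cyclic order until no move is available; the player making the last move wins. -}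

module Defs where

open import Data.Nat using (ℕ; zero; suc; _+_; _*_; _∸_; _≤_; _<_; _≡ᵇ_)
open import Data.Bool using (if_then_else_)
open import Data.Product using (Σ; ∃; _×_)
open import Relation.Binary.PropositionalEquality using (_≡_)
open import Relation.Binary.Construct.Closure.ReflexiveTransitive using (Star)
open import Relation.Nullary using (¬_)
open import Induction.WellFounded using (Acc)

-- The sequence: a 1 = 1, a 2 = 2, a (i+1) = i * a i + a (i-1) for i ≥ 2.
-- Index 0 is a dummy value (never used as a term of the sequence).
a : ℕ → ℕ
a zero = 0
a (suc zero) = 1
a (suc (suc zero)) = 2
a (suc (suc (suc k))) = suc (suc k) * a (suc (suc k)) + a (suc k)

-- A game state: a multiset of sequence terms, given by its multiplicities;
-- (S i) = number of copies of a i in the multiset (i ≥ 1; S 0 is unused and stays 0).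
State : Set
State = ℕ → ℕ

upd : State → ℕ → ℕ → State
upd f i v j = if j ≡ᵇ i then v else f j

initial : ℕ → State
initial n = upd (λ _ → 0) 1 n

data Move (f : State) : State → Set where
  combine₁ : 2 ≤ f 1 →
    Move f (upd (upd f 1 (f 1 ∸ 2)) 2 (f 2 + 1))
  -- for i = k+2 ≥ 2: i copies of a i and one a (i-1) → one a (i+1)
  combine : ∀ k → suc (suc k) ≤ f (suc (suc k)) → 1 ≤ f (suc k) →
    Move f (upd (upd (upd f (suc (suc k)) (f (suc (suc k)) ∸ suc (suc k)))
                             (suc k) (f (suc k) ∸ 1))
                       (suc (suc (suc k))) (f (suc (suc (suc k))) + 1))
  split₂ : 3 ≤ f 2 →
    Move f (upd (upd (upd f 2 (f 2 ∸ 3)) 1 (f 1 + 1)) 3 (f 3 + 1))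
  -- for i = k+3 ≥ 3: i+1 copies of a i → one a (i+1), i-2 copies of a (i-1), one a (i-2)
  split : ∀ k → suc (suc (suc (suc k))) ≤ f (suc (suc (suc k))) →
    Move f (upd (upd (upd (upd f (suc (suc (suc k)))
                                    (f (suc (suc (suc k))) ∸ suc (suc (suc (suc k)))))
                              (suc (suc (suc (suc k)))) (f (suc (suc (suc (suc k)))) + 1))
                        (suc (suc k)) (f (suc (suc k)) + suc k))
                  (suc k) (f (suc k) + 1))

Terminal : State → Set
Terminal f = ¬ (∃ λ g → Move f g)

Reachable : ℕ → State → Set
Reachable n f = Star Move (initial n) f

GameTerminates : State → Set
GameTerminates f = Acc (λ g h → Move h g) f

valueUpTo : ℕ → State → ℕ
valueUpTo zero s = 0
valueUpTo (suc N) s = valueUpTo N s + s (suc N) * a (suc N)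

IsLegalDecomposition : ℕ → State → Set
IsLegalDecomposition n s =
  (s 0 ≡ 0) ×
  (∀ i → s i ≤ i) ×
  (∀ i → s (suc (suc i)) ≡ suc (suc i) → s (suc i) ≡ 0) ×
  (Σ ℕ λ N → (∀ i → N < i → s i ≡ 0) × (valueUpTo N s ≡ n))

{-# OPTIONS --safe #-}
-- Every move preserves the value Σ sᵢ aᵢ: for combining this is the recurrence
-- a₍ᵢ₊₁₎ = i aᵢ + a₍ᵢ₋₁₎ itself, for splitting the consequence
-- a₍ᵢ₊₁₎ + (i-2) a₍ᵢ₋₁₎ + a₍ᵢ₋₂₎ = (i+1) aᵢ. Every move also strictly decreases the
-- number of terms Σ sᵢ, so all plays are finite. Finally, a state admitting no move is
-- legal: sᵢ > i would allow a split (a combination of two 1's if i = 1), and sᵢ = i with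
-- s₍ᵢ₋₁₎ > 0 would allow a combination.
module Submission where

open import Defs
open import Data.Nat using (ℕ; zero; suc; _+_; _*_; _∸_; _≤_; _<_; _≡ᵇ_; z≤n; s≤s; z<s; _≤?_; _≟_)
open import Data.Nat.Properties
open import Data.Nat.Tactic.RingSolver using (solve-∀)
open import Algebra.Properties.CommutativeSemigroup +-commutativeSemigroup using (xy∙z≈xz∙y)
open import Data.Bool using (true; false; T)
open import Data.Unit using (tt)
open import Data.Product using (Σ; _×_; _,_)
open import Function using (_∘_; id; const)
open import Relation.Nullary using (yes; no; contradiction)
open import Relation.Binary.PropositionalEquality
open import Relation.Binary.Construct.Closure.ReflexiveTransitive using (fold)
open import Induction.WellFounded using (acc)

upd-same : ∀ f i v → upd f i v i ≡ v
upd-same f i v with i ≡ᵇ i in eq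
... | true  = refl
... | false = contradiction (subst T eq (≡⇒≡ᵇ i i refl)) id

upd-other : ∀ f {i} v {j} → j ≢ i → upd f i v j ≡ f j
upd-other f {i} v {j} j≢i with j ≡ᵇ i in eq
... | false = refl
... | true  = contradiction (≡ᵇ⇒≡ j i (subst T (sym eq) tt)) j≢i

weightedSum : (ℕ → ℕ) → ℕ → State → ℕ
weightedSum w zero    f = 0
weightedSum w (suc M) f = weightedSum w M f + f (suc M) * w (suc M)

valueUpTo≡weightedSum : ∀ N f → valueUpTo N f ≡ weightedSum a N f
valueUpTo≡weightedSum zero    f = refl
valueUpTo≡weightedSum (suc N) f = cong (_+ f (suc N) * a (suc N)) (valueUpTo≡weightedSum N f)

weightedSum-cong : ∀ w M {f g} → (∀ j → j ≤ M → f j ≡ g j) → weightedSum w M f ≡ weightedSum w M g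
weightedSum-cong w zero    f≗g = refl
weightedSum-cong w (suc M) f≗g =
  cong₂ _+_ (weightedSum-cong w M (λ j j≤M → f≗g j (m≤n⇒m≤1+n j≤M)))
            (cong (_* w (suc M)) (f≗g (suc M) ≤-refl))

weightedSum-upd : ∀ w {M} f {i} v → suc i ≤ M →
  weightedSum w M (upd f (suc i) v) + f (suc i) * w (suc i) ≡ weightedSum w M f + v * w (suc i)
weightedSum-upd w {suc M} f {i} v i<1+M with suc i ≟ suc M
... | yes refl = begin
  weightedSum w M f′ + f′ (suc i) * w (suc i) + f (suc i) * w (suc i)
    ≡⟨ cong₂ (λ s x → s + x * w (suc i) + f (suc i) * w (suc i))
             (weightedSum-cong w M (λ j j≤M → upd-other f v (<⇒≢ (s≤s j≤M))))
             (upd-same f (suc i) v) ⟩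
  weightedSum w M f + v * w (suc i) + f (suc i) * w (suc i)
    ≡⟨ xy∙z≈xz∙y (weightedSum w M f) _ _ ⟩
  weightedSum w M f + f (suc i) * w (suc i) + v * w (suc i) ∎
  where open ≡-Reasoning
        f′ = upd f (suc i) v
... | no i≢M = begin
  weightedSum w M f′ + f′ (suc M) * w (suc M) + f (suc i) * w (suc i)
    ≡⟨ cong (λ x → weightedSum w M f′ + x * w (suc M) + f (suc i) * w (suc i))
            (upd-other f v (i≢M ∘ sym)) ⟩
  weightedSum w M f′ + f (suc M) * w (suc M) + f (suc i) * w (suc i)
    ≡⟨ xy∙z≈xz∙y (weightedSum w M f′) _ _ ⟩
  weightedSum w M f′ + f (suc i) * w (suc i) + f (suc M) * w (suc M)
    ≡⟨ cong (_+ f (suc M) * w (suc M)) (weightedSum-upd w f v (≤-pred (≤∧≢⇒< i<1+M i≢M))) ⟩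
  weightedSum w M f + v * w (suc i) + f (suc M) * w (suc M)
    ≡⟨ xy∙z≈xz∙y (weightedSum w M f) _ _ ⟩
  weightedSum w M f + f (suc M) * w (suc M) + v * w (suc i) ∎
  where open ≡-Reasoning
        f′ = upd f (suc i) v

weightedSum-take : ∀ w {M} f {i} c v → suc i ≤ M → f (suc i) ≡ c + v →
  weightedSum w M (upd f (suc i) v) + c * w (suc i) ≡ weightedSum w M f
weightedSum-take w {M} f {i} c v i<M fi≡c+v = +-cancelʳ-≡ (v * w (suc i)) _ _ (begin
  weightedSum w M f′ + c * w (suc i) + v * w (suc i)  ≡⟨ +-assoc (weightedSum w M f′) _ _ ⟩
  weightedSum w M f′ + (c * w (suc i) + v * w (suc i)) ≡⟨ cong (weightedSum w M f′ +_) (sym (*-distribʳ-+ _ c v)) ⟩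
  weightedSum w M f′ + (c + v) * w (suc i)            ≡⟨ cong (λ x → weightedSum w M f′ + x * w (suc i)) (sym fi≡c+v) ⟩
  weightedSum w M f′ + f (suc i) * w (suc i)          ≡⟨ weightedSum-upd w f v i<M ⟩
  weightedSum w M f + v * w (suc i)                   ∎)
  where open ≡-Reasoning
        f′ = upd f (suc i) v

weightedSum-put : ∀ w {M} f {i} c v → suc i ≤ M → v ≡ f (suc i) + c →
  weightedSum w M (upd f (suc i) v) ≡ weightedSum w M f + c * w (suc i)
weightedSum-put w {M} f {i} c v i<M v≡fi+c = +-cancelʳ-≡ (f (suc i) * w (suc i)) _ _ (begin
  weightedSum w M f′ + f (suc i) * w (suc i)            ≡⟨ weightedSum-upd w f v i<M ⟩
  weightedSum w M f + v * w (suc i)                     ≡⟨ cong (λ x → weightedSum w M f + x * w (suc i)) v≡fi+c ⟩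
  weightedSum w M f + (f (suc i) + c) * w (suc i)       ≡⟨ cong (weightedSum w M f +_) (*-distribʳ-+ _ (f (suc i)) c) ⟩
  weightedSum w M f + (f (suc i) * w (suc i) + c * w (suc i)) ≡⟨ sym (+-assoc (weightedSum w M f) _ _) ⟩
  weightedSum w M f + f (suc i) * w (suc i) + c * w (suc i)   ≡⟨ xy∙z≈xz∙y (weightedSum w M f) _ _ ⟩
  weightedSum w M f + c * w (suc i) + f (suc i) * w (suc i) ∎)
  where open ≡-Reasoning
        f′ = upd f (suc i) v

BoundedBy : ℕ → State → Set
BoundedBy N f = ∀ i → N < i → f i ≡ 0

occupied⇒≤bound : ∀ {N f} i → BoundedBy N f → 1 ≤ f i → i ≤ N
occupied⇒≤bound {N} i bnd fi>0 with i ≤? N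
... | yes i≤N = i≤N
... | no  i≰N = contradiction (bnd i (≰⇒> i≰N)) (>⇒≢ fi>0)

bounded-suc : ∀ {N f} → BoundedBy N f → BoundedBy (suc N) f
bounded-suc bnd j N<j = bnd j (<-trans (n<1+n _) N<j)

upd-bounded : ∀ {M f i} v → BoundedBy M f → i ≤ M → BoundedBy M (upd f i v)
upd-bounded {f = f} v bnd i≤M j M<j = trans (upd-other f v (>⇒≢ (≤-<-trans i≤M M<j))) (bnd j M<j)

removed : ∀ {f g} → Move f g → (ℕ → ℕ) → ℕ
removed (combine₁ _)    w = 2 * w 1
removed (combine k _ _) w = suc (suc k) * w (suc (suc k)) + w (suc k)
removed (split₂ _)      w = 3 * w 2
removed (split k _)     w = suc (suc (suc (suc k))) * w (suc (suc (suc k)))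

added : ∀ {f g} → Move f g → (ℕ → ℕ) → ℕ
added (combine₁ _)    w = w 2
added (combine k _ _) w = w (suc (suc (suc k)))
added (split₂ _)      w = w 1 + w 3
added (split k _)     w = w (suc (suc (suc (suc k)))) + suc k * w (suc (suc k)) + w (suc k)

move-bounded : ∀ {N f g} → Move f g → BoundedBy N f → BoundedBy (suc N) g
move-bounded (combine₁ p) bnd =
  upd-bounded _ (upd-bounded _ (bounded-suc bnd) (m+n≤o⇒n≤o 1 (s≤s i≤N))) (s≤s i≤N)
  where i≤N = occupied⇒≤bound 1 bnd (≤-trans z<s p)
move-bounded (combine k p _) bnd =
  upd-bounded _ (upd-bounded _ (upd-bounded _ (bounded-suc bnd)
    (m+n≤o⇒n≤o 1 (s≤s i≤N))) (m+n≤o⇒n≤o 2 (s≤s i≤N))) (s≤s i≤N)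
  where i≤N = occupied⇒≤bound (suc (suc k)) bnd (≤-trans z<s p)
move-bounded (split₂ p) bnd =
  upd-bounded _ (upd-bounded _ (upd-bounded _ (bounded-suc bnd)
    (m+n≤o⇒n≤o 1 (s≤s i≤N))) (m+n≤o⇒n≤o 2 (s≤s i≤N))) (s≤s i≤N)
  where i≤N = occupied⇒≤bound 2 bnd (≤-trans z<s p)
move-bounded (split k p) bnd =
  upd-bounded _ (upd-bounded _ (upd-bounded _ (upd-bounded _ (bounded-suc bnd)
    (m+n≤o⇒n≤o 1 (s≤s i≤N))) (s≤s i≤N)) (m+n≤o⇒n≤o 2 (s≤s i≤N))) (m+n≤o⇒n≤o 3 (s≤s i≤N))
  where i≤N = occupied⇒≤bound (suc (suc (suc k))) bnd (≤-trans z<s p)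

move-balance : ∀ {N f g} (m : Move f g) → BoundedBy N f → ∀ w →
  weightedSum w (suc N) g + removed m w ≡ weightedSum w (suc N) f + added m w
move-balance {N} {f} (combine₁ p) bnd w = begin
  Σw g + 2 * w 1                ≡⟨ cong (_+ 2 * w 1) put ⟩
  Σw f₁ + 1 * w 2 + 2 * w 1     ≡⟨ xy∙z≈xz∙y (Σw f₁) _ _ ⟩
  Σw f₁ + 2 * w 1 + 1 * w 2     ≡⟨ cong₂ _+_ take (*-identityˡ (w 2)) ⟩
  Σw f + w 2                    ∎
  where
  open ≡-Reasoning
  Σw = weightedSum w (suc N)
  i≤N = occupied⇒≤bound 1 bnd (≤-trans z<s p)
  f₁ = upd f 1 (f 1 ∸ 2)
  g = upd f₁ 2 (f 2 + 1)
  take : Σw f₁ + 2 * w 1 ≡ Σw f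
  take = weightedSum-take w f 2 (f 1 ∸ 2) (m+n≤o⇒n≤o 1 (s≤s i≤N)) (sym (m+[n∸m]≡n p))
  put : Σw g ≡ Σw f₁ + 1 * w 2
  put = weightedSum-put w f₁ 1 (f 2 + 1) (s≤s i≤N) refl
move-balance {N} {f} (combine k p q) bnd w = begin
  Σw g + (i * w i + w j)            ≡⟨ cong (_+ (i * w i + w j)) put ⟩
  Σw f₂ + 1 * w l + (i * w i + w j) ≡⟨ regroup (Σw f₂) (i * w i) (w j) (w l) ⟩
  Σw f₂ + 1 * w j + i * w i + w l   ≡⟨ cong (λ s → s + i * w i + w l) take₂ ⟩
  Σw f₁ + i * w i + w l             ≡⟨ cong (_+ w l) take₁ ⟩
  Σw f + w l                        ∎
  where
  open ≡-Reasoning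
  Σw = weightedSum w (suc N)
  j = suc k
  i = suc j
  l = suc i
  i≤N = occupied⇒≤bound i bnd (≤-trans z<s p)
  f₁ = upd f i (f i ∸ i)
  f₂ = upd f₁ j (f j ∸ 1)
  g = upd f₂ l (f l + 1)
  take₁ : Σw f₁ + i * w i ≡ Σw f
  take₁ = weightedSum-take w f i (f i ∸ i) (m+n≤o⇒n≤o 1 (s≤s i≤N)) (sym (m+[n∸m]≡n p))
  take₂ : Σw f₂ + 1 * w j ≡ Σw f₁
  take₂ = weightedSum-take w f₁ 1 (f j ∸ 1) (m+n≤o⇒n≤o 2 (s≤s i≤N))
    (trans (upd-other f _ (m≢1+n+m j {0})) (sym (m+[n∸m]≡n q)))
  put : Σw g ≡ Σw f₂ + 1 * w l
  put = weightedSum-put w f₂ 1 (f l + 1) (s≤s i≤N) (cong (_+ 1) (sym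
    (trans (upd-other f₁ _ (≢-sym (m≢1+n+m j {1}))) (upd-other f _ (≢-sym (m≢1+n+m i {0}))))))
  regroup : ∀ x y u z → x + 1 * z + (y + u) ≡ x + 1 * u + y + z
  regroup = solve-∀
move-balance {N} {f} (split₂ p) bnd w = begin
  Σw g + 3 * w 2                    ≡⟨ cong (_+ 3 * w 2) (trans put₂ (cong (_+ 1 * w 3) put₁)) ⟩
  Σw f₁ + 1 * w 1 + 1 * w 3 + 3 * w 2 ≡⟨ regroup (Σw f₁) (w 1) (w 3) (3 * w 2) ⟩
  Σw f₁ + 3 * w 2 + (w 1 + w 3)     ≡⟨ cong (_+ (w 1 + w 3)) take ⟩
  Σw f + (w 1 + w 3)                ∎
  where
  open ≡-Reasoning
  Σw = weightedSum w (suc N)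
  i≤N = occupied⇒≤bound 2 bnd (≤-trans z<s p)
  f₁ = upd f 2 (f 2 ∸ 3)
  f₂ = upd f₁ 1 (f 1 + 1)
  g = upd f₂ 3 (f 3 + 1)
  take : Σw f₁ + 3 * w 2 ≡ Σw f
  take = weightedSum-take w f 3 (f 2 ∸ 3) (m+n≤o⇒n≤o 1 (s≤s i≤N)) (sym (m+[n∸m]≡n p))
  put₁ : Σw f₂ ≡ Σw f₁ + 1 * w 1
  put₁ = weightedSum-put w f₁ 1 (f 1 + 1) (m+n≤o⇒n≤o 2 (s≤s i≤N)) refl
  put₂ : Σw g ≡ Σw f₂ + 1 * w 3
  put₂ = weightedSum-put w f₂ 1 (f 3 + 1) (s≤s i≤N) refl
  regroup : ∀ x y z u → x + 1 * y + 1 * z + u ≡ x + u + (y + z)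
  regroup = solve-∀
move-balance {N} {f} (split k p) bnd w = begin
  Σw g + i′ * w i
    ≡⟨ cong (_+ i′ * w i) (trans put₃ (cong (_+ 1 * w j) (trans put₂ (cong (_+ suc k * w h) put₁)))) ⟩
  Σw f₁ + 1 * w i′ + suc k * w h + 1 * w j + i′ * w i
    ≡⟨ regroup (Σw f₁) (w i′) (suc k * w h) (w j) (i′ * w i) ⟩
  Σw f₁ + i′ * w i + (w i′ + suc k * w h + w j)
    ≡⟨ cong (_+ (w i′ + suc k * w h + w j)) take ⟩
  Σw f + (w i′ + suc k * w h + w j)  ∎
  where
  open ≡-Reasoning
  Σw = weightedSum w (suc N)
  j = suc k
  h = suc j
  i = suc h
  i′ = suc i
  i≤N = occupied⇒≤bound i bnd (≤-trans z<s p)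
  f₁ = upd f i (f i ∸ i′)
  f₂ = upd f₁ i′ (f i′ + 1)
  f₃ = upd f₂ h (f h + j)
  g = upd f₃ j (f j + 1)
  take : Σw f₁ + i′ * w i ≡ Σw f
  take = weightedSum-take w f i′ (f i ∸ i′) (m+n≤o⇒n≤o 1 (s≤s i≤N)) (sym (m+[n∸m]≡n p))
  put₁ : Σw f₂ ≡ Σw f₁ + 1 * w i′
  put₁ = weightedSum-put w f₁ 1 (f i′ + 1) (s≤s i≤N) (cong (_+ 1) (sym (upd-other f _ (≢-sym (m≢1+n+m i {0})))))
  put₂ : Σw f₃ ≡ Σw f₂ + j * w h
  put₂ = weightedSum-put w f₂ j (f h + j) (m+n≤o⇒n≤o 2 (s≤s i≤N)) (cong (_+ j) (sym
    (trans (upd-other f₁ _ (m≢1+n+m h {1})) (upd-other f _ (m≢1+n+m h {0})))))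
  put₃ : Σw g ≡ Σw f₃ + 1 * w j
  put₃ = weightedSum-put w f₃ 1 (f j + 1) (m+n≤o⇒n≤o 3 (s≤s i≤N)) (cong (_+ 1) (sym
    (trans (upd-other f₂ _ (m≢1+n+m j {0}))
      (trans (upd-other f₁ _ (m≢1+n+m j {2})) (upd-other f _ (m≢1+n+m j {1}))))))
  regroup : ∀ x p q r s → x + 1 * p + q + 1 * r + s ≡ x + s + (p + q + r)
  regroup = solve-∀

a-split-identity : ∀ k →
  a (suc (suc (suc (suc k)))) + suc k * a (suc (suc k)) + a (suc k) ≡ suc (suc (suc (suc k))) * a (suc (suc (suc k)))
a-split-identity k = identity k (a (suc (suc k))) (a (suc k))
  where
  identity : ∀ k p q → let r = suc (suc k) * p + q in
    suc (suc (suc k)) * r + p + suc k * p + q ≡ suc (suc (suc (suc k))) * r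
  identity = solve-∀

removed-a≡added-a : ∀ {f g} (m : Move f g) → removed m a ≡ added m a
removed-a≡added-a (combine₁ _)    = refl
removed-a≡added-a (combine k _ _) = refl
removed-a≡added-a (split₂ _)      = refl
removed-a≡added-a (split k _)     = sym (a-split-identity k)

added<removed-tokens : ∀ {f g} (m : Move f g) → added m (const 1) < removed m (const 1)
added<removed-tokens (combine₁ _)    = ≤-refl
added<removed-tokens (combine k _ _) = s≤s (s≤s z≤n)
added<removed-tokens (split₂ _)      = ≤-refl
added<removed-tokens (split k _)     = s≤s (s≤s (s≤s (≤-reflexive (+-comm (k * 1) 1))))

weightedSum-bounded : ∀ w {N f} → BoundedBy N f → weightedSum w (suc N) f ≡ weightedSum w N f
weightedSum-bounded w {N} {f} bnd = begin
  weightedSum w N f + f (suc N) * w (suc N) ≡⟨ cong (λ x → weightedSum w N f + x * w (suc N)) (bnd (suc N) ≤-refl) ⟩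
  weightedSum w N f + 0                     ≡⟨ +-identityʳ _ ⟩
  weightedSum w N f                         ∎
  where open ≡-Reasoning

move-preserves-value : ∀ {N f g} → Move f g → BoundedBy N f → weightedSum a (suc N) g ≡ weightedSum a N f
move-preserves-value {N} {f} {g} m bnd = +-cancelʳ-≡ (removed m a) _ _ (begin
  weightedSum a (suc N) g + removed m a ≡⟨ move-balance m bnd a ⟩
  weightedSum a (suc N) f + added m a   ≡⟨ cong₂ _+_ (weightedSum-bounded a bnd) (sym (removed-a≡added-a m)) ⟩
  weightedSum a N f + removed m a       ∎)
  where open ≡-Reasoning

tokens : ℕ → State → ℕ
tokens = weightedSum (const 1)

move-decreases-tokens : ∀ {N f g} → Move f g → BoundedBy N f → tokens (suc N) g < tokens N f
move-decreases-tokens {N} {f} {g} m bnd = +-cancelʳ-< (added m (const 1)) _ _ (begin-strict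
  tokens (suc N) g + added m (const 1)   <⟨ +-monoʳ-< (tokens (suc N) g) (added<removed-tokens m) ⟩
  tokens (suc N) g + removed m (const 1) ≡⟨ move-balance m bnd (const 1) ⟩
  tokens (suc N) f + added m (const 1)   ≡⟨ cong (_+ added m (const 1)) (weightedSum-bounded (const 1) bnd) ⟩
  tokens N f + added m (const 1)         ∎)
  where open ≤-Reasoning

terminates-within : ∀ t {N f} → BoundedBy N f → tokens N f < t → GameTerminates f
terminates-within (suc t) bnd tokens<1+t = acc λ m →
  terminates-within t (move-bounded m bnd) (<-≤-trans (move-decreases-tokens m bnd) (≤-pred tokens<1+t))

bounded⇒terminates : ∀ {N f} → BoundedBy N f → GameTerminates f
bounded⇒terminates bnd = terminates-within _ bnd ≤-refl

IsDecomposition : ℕ → State → Set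
IsDecomposition n f = (f 0 ≡ 0) × Σ ℕ λ N → BoundedBy N f × (valueUpTo N f ≡ n)

move-fixes-0 : ∀ {f g} → Move f g → g 0 ≡ f 0
move-fixes-0 (combine₁ _)    = refl
move-fixes-0 (combine _ _ _) = refl
move-fixes-0 (split₂ _)      = refl
move-fixes-0 (split _ _)     = refl

move-preserves-decomposition : ∀ {n f g} → Move f g → IsDecomposition n f → IsDecomposition n g
move-preserves-decomposition {n} {f} {g} m (f0≡0 , N , bnd , value≡n) =
  trans (move-fixes-0 m) f0≡0 , suc N , move-bounded m bnd , (begin
    valueUpTo (suc N) g     ≡⟨ valueUpTo≡weightedSum (suc N) g ⟩
    weightedSum a (suc N) g ≡⟨ move-preserves-value m bnd ⟩
    weightedSum a N f       ≡⟨ sym (valueUpTo≡weightedSum N f) ⟩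
    valueUpTo N f           ≡⟨ value≡n ⟩
    n                       ∎)
  where open ≡-Reasoning

initial-bounded : ∀ n → BoundedBy 1 (initial n)
initial-bounded n j 1<j = upd-other (const 0) n (>⇒≢ 1<j)

initial-isDecomposition : ∀ n → IsDecomposition n (initial n)
initial-isDecomposition n = refl , 1 , initial-bounded n , *-identityʳ n

reachable⇒isDecomposition : ∀ {n f} → Reachable n f → IsDecomposition n f
reachable⇒isDecomposition {n} r =
  fold (λ f g → IsDecomposition n f → IsDecomposition n g)
       (λ m preserve → preserve ∘ move-preserves-decomposition m) id r (initial-isDecomposition n)

terminal⇒coefficient≤index : ∀ {f} → Terminal f → f 0 ≡ 0 → ∀ i → f i ≤ i
terminal⇒coefficient≤index t f0≡0 zero = ≤-reflexive f0≡0
terminal⇒coefficient≤index {f} t _ 1 with 2 ≤? f 1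
... | yes p = contradiction (_ , combine₁ p) t
... | no  p = ≤-pred (≰⇒> p)
terminal⇒coefficient≤index {f} t _ 2 with 3 ≤? f 2
... | yes p = contradiction (_ , split₂ p) t
... | no  p = ≤-pred (≰⇒> p)
terminal⇒coefficient≤index {f} t _ (suc (suc (suc k))) with suc (suc (suc (suc k))) ≤? f (suc (suc (suc k)))
... | yes p = contradiction (_ , split k p) t
... | no  p = ≤-pred (≰⇒> p)

terminal⇒full⇒previous-empty : ∀ {f} → Terminal f → ∀ i → f (suc (suc i)) ≡ suc (suc i) → f (suc i) ≡ 0
terminal⇒full⇒previous-empty {f} t i full with f (suc i) ≟ 0
... | yes empty    = empty
... | no  occupied = contradiction (_ , combine i (≤-reflexive (sym full)) (n≢0⇒n>0 occupied)) t

terminal⇒legal : ∀ {n f} → Terminal f → IsDecomposition n f → IsLegalDecomposition n f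
terminal⇒legal t (f0≡0 , rest) =
  f0≡0 , terminal⇒coefficient≤index t f0≡0 , terminal⇒full⇒previous-empty t , rest

theorem6p2 : (n : ℕ) → 1 ≤ n →
    GameTerminates (initial n) ×
    ((f : State) → Reachable n f → Terminal f → IsLegalDecomposition n f)
theorem6p2 n _ =
  bounded⇒terminates (initial-bounded n) ,
  λ f reachable terminal → terminal⇒legal terminal (reachable⇒isDecomposition reachable)
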